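{- For every $g\ge 2$, the $1$-power domination number of the Sierpiński graph $\mathcal{S}_g$ satisfies $\gamma_{P,1}(\mathcal{S}_g)\ge \dfrac{3^{g-2}+1}{2}$.
   Context: Sierpiński graph: $\mathcal{S}_1$ is a triangle whose three vertices are its outmost vertices. Given $\mathcal{S}_g$ with outmost vertices $A_g,B_g,C_g$, take three copies $\mathcal{S}_g^\theta$ ($\theta=1,2,3$) with outmost vertices $A_g^\theta,B_g^\theta,C_g^\theta$, identify $B_g^1$ with $A_g^2$, $C_g^2$ with $B_g^3$, and $C_g^1$ with $A_g^3$; the result is $\mathcal{S}_{g+1}$, with outmost vertices $A_g^1$, $B_g^2$, $C_g^3$. For a graph $G$ and $D\subseteq V(G)$: $P^0_{G,1}(D)=N_G[D]$ (closed neighborhood), $P^{i+1}_{G,1}(D)=\bigcup\{N_G[v]: v\in P^i_{G,1}(D),\ |N_G[v]\setminus P^i_{G,1}(D)|\le 1\}$; the increasing sequence stabilizes at $P^\infty_{G,1}(D)$. $D$ is a $1$-power dominating set if $P^\infty_{G,1}(D)=V(G)$; $\gamma_{P,1}(G)$ is the minimum size of such a set. -}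

module Defs where

open import Data.Nat using (ℕ; zero; suc)
open import Data.Bool using (Bool; true; false; T; not; _∧_)
open import Data.Unit using (⊤; tt)
open import Data.Fin using (Fin; zero; suc)
open import Data.Fin.Properties as FinP using ()
open import Data.Product using (Σ; ∃; _×_; _,_; proj₁; proj₂)
open import Data.Product.Properties using (≡-dec)
open import Data.Sum using (_⊎_)
open import Data.List using (List)
open import Data.List.Membership.Propositional using (_∈_)
open import Relation.Nullary using (¬_; yes; no; Dec)
open import Relation.Nullary.Decidable using (⌊_⌋)
open import Relation.Binary.Definitions using (DecidableEquality)
open import Relation.Binary.PropositionalEquality using (_≡_; refl; cong)

record Graph : Set₁ where
  field
    V    : Set
    _≟_  : DecidableEquality V
    Adj  : V → V → Set
    A B C : V

-- Gluing three copies (θ = 0,1,2 here, i.e. copies 1,2,3 of the paper).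
-- Identifications: B¹ = A², C² = B³, C¹ = A³.
-- A vertex of the glued graph is a pair (θ , v) that is the canonical
-- representative of its class: copy 0 keeps everything, copy 1 drops A
-- (identified with B of copy 0), copy 2 drops B (identified with C of
-- copy 1) and A (identified with C of copy 0).

module Glue (G : Graph) where
  open Graph G

  isCanonical : Fin 3 × V → Bool
  isCanonical (zero , v)             = true
  isCanonical (suc zero , v)         = not ⌊ v ≟ A ⌋
  isCanonical (suc (suc zero) , v)   = not ⌊ v ≟ A ⌋ ∧ not ⌊ v ≟ B ⌋

  V' : Set
  V' = Σ (Fin 3 × V) (λ p → T (isCanonical p))

  notYes : ∀ {X : Set} (d : Dec X) → ¬ X → T (not ⌊ d ⌋)
  notYes (yes x) nx = nx x
  notYes (no _)  nx = tt

  bothT : ∀ {a b} → T a → T b → T (a ∧ b)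
  bothT {true} {true} _ _ = tt

  canon : Fin 3 → V → V'
  canon zero v = (zero , v) , tt
  canon (suc zero) v with v ≟ A
  ... | yes _ = (zero , B) , tt
  ... | no  v≢A = (suc zero , v) , notYes (v ≟ A) v≢A
  canon (suc (suc zero)) v with v ≟ B
  ... | yes _ = canon (suc zero) C
  ... | no  v≢B with v ≟ A
  ...   | yes _ = (zero , C) , tt
  ...   | no  v≢A = (suc (suc zero) , v) , bothT (notYes (v ≟ A) v≢A) (notYes (v ≟ B) v≢B)

  T-irr : ∀ b (p q : T b) → p ≡ q
  T-irr true  tt tt = refl

  _≟'_ : DecidableEquality V'
  ((θ , v) , p) ≟' ((θ' , v') , q) with ≡-dec FinP._≟_ _≟_ (θ , v) (θ' , v')
  ... | no ne = no (λ e → ne (cong proj₁ e))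
  ... | yes refl with T-irr (isCanonical (θ , v)) p q
  ...   | refl = yes refl

  Adj' : V' → V' → Set
  Adj' x y = ∃ λ θ → ∃ λ u → ∃ λ w → Adj u w × canon θ u ≡ x × canon θ w ≡ y

  glued : Graph
  glued = record
    { V = V' ; _≟_ = _≟'_ ; Adj = Adj'
    ; A = canon zero A ; B = canon (suc zero) B ; C = canon (suc (suc zero)) C }

-- S 0 is 𝒮₁ (triangle), S (suc k) = glue of three copies of S k.
-- Hence 𝒮_g = S (g ∸ 1).
triangle : Graph
triangle = record
  { V = Fin 3 ; _≟_ = FinP._≟_ ; Adj = λ u v → ¬ u ≡ v
  ; A = zero ; B = suc zero ; C = suc (suc zero) }

S : ℕ → Graph
S zero    = triangle
S (suc k) = Glue.glued (S k)

module PowerDomination (G : Graph) where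
  open Graph G

  InN : V → V → Set
  InN v x = x ≡ v ⊎ Adj v x

  P : ℕ → List V → V → Set
  P zero    D x = ∃ λ d → d ∈ D × InN d x
  P (suc i) D x = ∃ λ v → P i D v
                        × (∀ a b → InN v a → ¬ P i D a → InN v b → ¬ P i D b → a ≡ b)
                        × InN v x

  P∞ : List V → V → Set
  P∞ D x = ∃ λ i → P i D x

  IsPowerDominating : List V → Set
  IsPowerDominating D = ∀ x → P∞ D x

-- 𝒮_{m+2} is the union of 3^m copies of 𝒮₂ which meet only in outmost
-- vertices, and no vertex lies in three copies.  The three inner vertices of a
-- copy form a fort: each of their outside neighbours is an outmost vertex of
-- the copy and sees two of them.  A power dominating set D has N[D] meeting
-- every fort, and the inner vertices have all their neighbours in the copy,
-- so every copy contains a vertex of D.  Counting with multiplicity at most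
-- two gives 3^m ≤ 2|D|, and equality is impossible because 3^m is odd.
module Submission where

open import Defs
open import Data.Nat using (ℕ; zero; suc; _+_; _*_; _∸_; _^_; _≤_; s≤s)
open import Data.Nat.Properties using (+-comm; *-comm; ≤∧≢⇒<)
open import Data.Nat.DivMod using (_%_; [m+kn]%n≡m%n; m*n%n≡0)
open import Data.Unit using (tt)
open import Data.Empty using (⊥; ⊥-elim)
open import Data.Fin using (Fin; zero; suc; combine; remQuot) renaming (_<_ to _<ᶠ_)
import Data.Fin.Properties as Fin
open import Data.Product using (∃; ∃₂; _×_; _,_; proj₁; proj₂; uncurry)
open import Data.Product.Properties using (≡-dec)
open import Data.Sum using (_⊎_; inj₁; inj₂; [_,_])
import Data.Sum as Sum
open import Data.Vec using (Vec; []; _∷_)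
open import Data.Vec.Properties using (∷-injectiveˡ; ∷-injectiveʳ)
open import Data.List using (List; []; _∷_; length; lookup)
open import Data.List.Relation.Unary.Any using (Any; here; there; index; satisfied; any?)
open import Data.List.Relation.Unary.Any.Properties using (lookup-index)
open import Data.List.Membership.Propositional using (_∈_; lose)
open import Data.List.Relation.Unary.Unique.Propositional using (Unique)
open import Function using (_∘_)
open import Relation.Binary.Definitions using (tri<; tri≈; tri>)
open import Relation.Nullary using (¬_; Dec; yes; no)
open import Relation.Nullary.Decidable using (from-yes; from-no; map′; _×-dec_; _⊎-dec_; _→-dec_)
open import Relation.Binary.PropositionalEquality
  using (_≡_; _≢_; refl; sym; trans; cong; cong₂; subst; subst₂; ≢-sym; module ≡-Reasoning)

Vertex : ℕ → Set
Vertex n = Graph.V (S n)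

Adjacent : ∀ n → Vertex n → Vertex n → Set
Adjacent n = Graph.Adj (S n)

outmost : (G : Graph) → Fin 3 → Graph.V G
outmost G zero             = Graph.A G
outmost G (suc zero)       = Graph.B G
outmost G (suc (suc zero)) = Graph.C G

IsOutmost : (G : Graph) → Graph.V G → Set
IsOutmost G v = ∃ λ s → v ≡ outmost G s

outmost? : (G : Graph) (v : Graph.V G) → Dec (IsOutmost G v)
outmost? G v = Fin.any? (λ s → Graph._≟_ G v (outmost G s))

_≟²_ : (p q : Fin 3 × Fin 3) → Dec (p ≡ q)
_≟²_ = ≡-dec Fin._≟_ Fin._≟_

-- The glued vertex canon θ (outmost G s) is stored as the outmost vertex s′
-- of copy θ′, where (θ′ , s′) = representative θ s.
representative : Fin 3 → Fin 3 → Fin 3 × Fin 3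
representative zero             s                = zero , s
representative (suc zero)       zero             = zero , suc zero
representative (suc zero)       s                = suc zero , s
representative (suc (suc zero)) zero             = zero , suc (suc zero)
representative (suc (suc zero)) (suc zero)       = suc zero , suc (suc zero)
representative (suc (suc zero)) (suc (suc zero)) = suc (suc zero) , suc (suc zero)

representative-injective : ∀ θ s t → representative θ s ≡ representative θ t → s ≡ t
representative-injective = from-yes (Fin.all? λ θ → Fin.all? λ s → Fin.all? λ t →
  (representative θ s ≟² representative θ t) →-dec (s Fin.≟ t))

representative-diagonal : ∀ θ s t → representative θ s ≡ representative t t → θ ≡ t × s ≡ t
representative-diagonal = from-yes (Fin.all? λ θ → Fin.all? λ s → Fin.all? λ t →
  (representative θ s ≟² representative t t) →-dec ((θ Fin.≟ t) ×-dec (s Fin.≟ t)))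

representative-atMostTwo : ∀ θa θb θc sa sb sc →
  representative θa sa ≡ representative θb sb → representative θa sa ≡ representative θc sc →
  θa ≡ θb ⊎ θa ≡ θc ⊎ θb ≡ θc
representative-atMostTwo = from-yes
  (Fin.all? λ θa → Fin.all? λ θb → Fin.all? λ θc → Fin.all? λ sa → Fin.all? λ sb → Fin.all? λ sc →
    (representative θa sa ≟² representative θb sb) →-dec (representative θa sa ≟² representative θc sc)
      →-dec ((θa Fin.≟ θb) ⊎-dec (θa Fin.≟ θc) ⊎-dec (θb Fin.≟ θc)))

module GlueProperties (G : Graph)
  (outmost-injective : ∀ {s t} → outmost G s ≡ outmost G t → s ≡ t) where

  open Graph G
  open Glue G

  corner : Fin 3 × Fin 3 → Fin 3 × V
  corner (θ , s) = θ , outmost G s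

  corner-injective : ∀ {p q} → corner p ≡ corner q → p ≡ q
  corner-injective {_ , s} {_ , t} e = cong₂ _,_ (cong proj₁ e) (outmost-injective (cong proj₂ e))

  inner≢corner : ∀ {θ v} p → ¬ IsOutmost G v → (θ , v) ≢ corner p
  inner≢corner p v-inner e = v-inner (proj₂ p , cong proj₂ e)

  keys≡ : ∀ {x y : V'} {a b : Fin 3 × V} → proj₁ x ≡ a → x ≡ y → proj₁ y ≡ b → a ≡ b
  keys≡ p refl q = trans (sym p) q

  outmost≢ : ∀ s t → s ≢ t → outmost G s ≢ outmost G t
  outmost≢ _ _ s≢t = s≢t ∘ outmost-injective

  canon-outmost : ∀ θ s → proj₁ (canon θ (outmost G s)) ≡ corner (representative θ s)
  canon-outmost zero s = refl
  canon-outmost (suc zero) zero with A ≟ A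
  ... | yes _ = refl
  ... | no A≢A = ⊥-elim (A≢A refl)
  canon-outmost (suc zero) (suc zero) with B ≟ A
  ... | yes B≡A = ⊥-elim (outmost≢ (suc zero) zero (λ ()) B≡A)
  ... | no _ = refl
  canon-outmost (suc zero) (suc (suc zero)) with C ≟ A
  ... | yes C≡A = ⊥-elim (outmost≢ (suc (suc zero)) zero (λ ()) C≡A)
  ... | no _ = refl
  canon-outmost (suc (suc zero)) zero with A ≟ B
  ... | yes A≡B = ⊥-elim (outmost≢ zero (suc zero) (λ ()) A≡B)
  ... | no _ with A ≟ A
  ...   | yes _ = refl
  ...   | no A≢A = ⊥-elim (A≢A refl)
  canon-outmost (suc (suc zero)) (suc zero) with B ≟ B
  ... | yes _ = canon-outmost (suc zero) (suc (suc zero))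
  ... | no B≢B = ⊥-elim (B≢B refl)
  canon-outmost (suc (suc zero)) (suc (suc zero)) with C ≟ B
  ... | yes C≡B = ⊥-elim (outmost≢ (suc (suc zero)) (suc zero) (λ ()) C≡B)
  ... | no _ with C ≟ A
  ...   | yes C≡A = ⊥-elim (outmost≢ (suc (suc zero)) zero (λ ()) C≡A)
  ...   | no _ = refl

  canon-inner : ∀ θ {v} → ¬ IsOutmost G v → proj₁ (canon θ v) ≡ (θ , v)
  canon-inner zero _ = refl
  canon-inner (suc zero) {v} v-inner with v ≟ A
  ... | yes v≡A = ⊥-elim (v-inner (zero , v≡A))
  ... | no _ = refl
  canon-inner (suc (suc zero)) {v} v-inner with v ≟ B
  ... | yes v≡B = ⊥-elim (v-inner (suc zero , v≡B))
  ... | no _ with v ≟ A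
  ...   | yes v≡A = ⊥-elim (v-inner (zero , v≡A))
  ...   | no _ = refl

  data CanonView (θ : Fin 3) : V → Set where
    inner : ∀ {v} → ¬ IsOutmost G v → proj₁ (canon θ v) ≡ (θ , v) → CanonView θ v
    outer : ∀ s → CanonView θ (outmost G s)

  canonView : ∀ θ v → CanonView θ v
  canonView θ v with outmost? G v
  ... | yes (s , refl) = outer s
  ... | no v-inner = inner v-inner (canon-inner θ v-inner)

  canon-injective : ∀ θ {u v} → canon θ u ≡ canon θ v → u ≡ v
  canon-injective θ {u} {v} e with canonView θ u | canonView θ v
  ... | inner _ pu | inner _ pv = cong proj₂ (keys≡ pu e pv)
  ... | inner u-inner pu | outer t =
    ⊥-elim (inner≢corner (representative θ t) u-inner (keys≡ pu e (canon-outmost θ t)))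
  ... | outer s | inner v-inner pv =
    ⊥-elim (inner≢corner (representative θ s) v-inner (keys≡ pv (sym e) (canon-outmost θ s)))
  ... | outer s | outer t =
    cong (outmost G) (representative-injective θ s t
      (corner-injective (keys≡ (canon-outmost θ s) e (canon-outmost θ t))))

  canon-shared : ∀ {θ θ′ u v} → θ ≢ θ′ → canon θ u ≡ canon θ′ v → IsOutmost G u
  canon-shared {θ} {θ′} {u} {v} θ≢θ′ e with canonView θ u | canonView θ′ v
  ... | outer s | _ = s , refl
  ... | inner _ pu | inner _ pv = ⊥-elim (θ≢θ′ (cong proj₁ (keys≡ pu e pv)))
  ... | inner u-inner pu | outer t =
    ⊥-elim (inner≢corner (representative θ′ t) u-inner (keys≡ pu e (canon-outmost θ′ t)))

  canon-outmost-unique : ∀ θ t {u} → canon θ u ≡ canon t (outmost G t) → θ ≡ t × u ≡ outmost G t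
  canon-outmost-unique θ t {u} e with canonView θ u
  ... | inner u-inner pu =
    ⊥-elim (inner≢corner (representative t t) u-inner (keys≡ pu e (canon-outmost t t)))
  ... | outer s with representative-diagonal θ s t
                       (corner-injective (keys≡ (canon-outmost θ s) e (canon-outmost t t)))
  ...   | refl , refl = refl , refl

  canon-noThreeCopies : ∀ {θa θb θc ua ub uc} → θa ≢ θb → θa ≢ θc → θb ≢ θc →
    canon θa ua ≡ canon θb ub → canon θa ua ≡ canon θc uc → ⊥
  canon-noThreeCopies {θa} {θb} {θc} θa≢θb θa≢θc θb≢θc eab eac
    with canon-shared θa≢θb eab
       | canon-shared (≢-sym θa≢θb) (sym eab)
       | canon-shared (≢-sym θa≢θc) (sym eac)
  ... | sa , refl | sb , refl | sc , refl =
    [ θa≢θb , [ θa≢θc , θb≢θc ] ] (representative-atMostTwo θa θb θc sa sb sc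
      (corner-injective (keys≡ (canon-outmost θa sa) eab (canon-outmost θb sb)))
      (corner-injective (keys≡ (canon-outmost θa sa) eac (canon-outmost θc sc))))

  glued-outmost : ∀ t → outmost glued t ≡ canon t (outmost G t)
  glued-outmost zero             = refl
  glued-outmost (suc zero)       = refl
  glued-outmost (suc (suc zero)) = refl

  glued-outmost-injective : ∀ {s t} → outmost glued s ≡ outmost glued t → s ≡ t
  glued-outmost-injective {s} {t} e =
    proj₁ (canon-outmost-unique s t (trans (sym (glued-outmost s)) (trans e (glued-outmost t))))

triangle-outmost : ∀ s → outmost triangle s ≡ s
triangle-outmost zero             = refl
triangle-outmost (suc zero)       = refl
triangle-outmost (suc (suc zero)) = refl

S-outmost-injective : ∀ k {s t} → outmost (S k) s ≡ outmost (S k) t → s ≡ t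
S-outmost-injective zero {s} {t} e = subst₂ _≡_ (triangle-outmost s) (triangle-outmost t) e
S-outmost-injective (suc k) = GlueProperties.glued-outmost-injective (S k) (S-outmost-injective k)

module S-Glue (k : ℕ) = GlueProperties (S k) (S-outmost-injective k)

-- Copies live in S (m + k) rather than S (k + m) so that S (suc m + k)
-- unfolds to the glue of S (m + k); lemma6 transports along m + 1 ≡ suc m.
module Copies (k : ℕ) where

  Address : ℕ → Set
  Address = Vec (Fin 3)

  embed : ∀ m → Address m → Vertex k → Vertex (m + k)
  embed zero    []      u = u
  embed (suc m) (θ ∷ a) u = Glue.canon (S (m + k)) θ (embed m a u)

  InCopy : ∀ m → Address m → Vertex (m + k) → Set
  InCopy m a x = ∃ λ u → x ≡ embed m a u

  embed-injective : ∀ m a {u v} → embed m a u ≡ embed m a v → u ≡ v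
  embed-injective zero    []      e = e
  embed-injective (suc m) (θ ∷ a) e = embed-injective m a (S-Glue.canon-injective (m + k) θ e)

  embed-adjacent : ∀ m a {u w} → Adjacent k u w → Adjacent (m + k) (embed m a u) (embed m a w)
  embed-adjacent zero    []      adj = adj
  embed-adjacent (suc m) (θ ∷ a) adj = θ , _ , _ , embed-adjacent m a adj , refl , refl

  embed-inner : ∀ m a {u} → ¬ IsOutmost (S k) u → ¬ IsOutmost (S (m + k)) (embed m a u)
  embed-inner zero    []      u-inner = u-inner
  embed-inner (suc m) (θ ∷ a) u-inner (t , e) =
    embed-inner m a u-inner (t , proj₂ (canon-outmost-unique θ t (trans e (glued-outmost t))))
    where open S-Glue (m + k)

  embed-outmost-unique : ∀ m a b {u v} t →
    embed m a u ≡ outmost (S (m + k)) t → embed m b v ≡ outmost (S (m + k)) t → a ≡ b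
  embed-outmost-unique zero    []        []        t _  _  = refl
  embed-outmost-unique (suc m) (θa ∷ a) (θb ∷ b) t ea eb
    with canon-outmost-unique θa t (trans ea (glued-outmost t))
       | canon-outmost-unique θb t (trans eb (glued-outmost t))
    where open S-Glue (m + k)
  ... | refl , ea′ | refl , eb′ = cong (t ∷_) (embed-outmost-unique m a b t ea′ eb′)

  embed-neighbour : ∀ m a {u y} → ¬ IsOutmost (S k) u →
    Adjacent (m + k) y (embed m a u) → InCopy m a y
  embed-neighbour zero    []      {y = y} _ _ = y , refl
  embed-neighbour (suc m) (θ ∷ a) u-inner (θ′ , u′ , w′ , adj , refl , e) with θ′ Fin.≟ θ
  ... | no θ′≢θ = ⊥-elim (embed-inner m a u-inner (canon-shared (≢-sym θ′≢θ) (sym e)))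
    where open S-Glue (m + k)
  ... | yes refl with S-Glue.canon-injective (m + k) θ e
  ...   | refl with embed-neighbour m a u-inner adj
  ...     | w , refl = w , refl

  sameBranch-meetingOtherBranch⇒≡ : ∀ m {θ θ′} a b c {ua ub uc} → θ ≢ θ′ →
    embed (suc m) (θ ∷ a) ua ≡ embed (suc m) (θ ∷ b) ub →
    embed (suc m) (θ ∷ a) ua ≡ embed (suc m) (θ′ ∷ c) uc → a ≡ b
  sameBranch-meetingOtherBranch⇒≡ m {θ} a b c θ≢θ′ eab eac with canon-shared θ≢θ′ eac
    where open S-Glue (m + k)
  ... | s , ea = embed-outmost-unique m a b s ea (trans (sym (S-Glue.canon-injective (m + k) θ eab)) ea)

  atMostTwoCopies : ∀ m a b c {x} → InCopy m a x → InCopy m b x → InCopy m c x →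
    a ≡ b ⊎ a ≡ c ⊎ b ≡ c
  atMostTwoCopies zero [] [] [] _ _ _ = inj₁ refl
  atMostTwoCopies (suc m) (θa ∷ a) (θb ∷ b) (θc ∷ c) (ua , refl) (ub , eb) (uc , ec)
    with θa Fin.≟ θb | θa Fin.≟ θc | θb Fin.≟ θc
  ... | yes refl | yes refl | _ =
    Sum.map (cong (θa ∷_)) (Sum.map (cong (θa ∷_)) (cong (θa ∷_)))
      (atMostTwoCopies m a b c (ua , refl) (ub , canon-injective θa eb)
                                           (uc , canon-injective θa ec))
    where open S-Glue (m + k)
  ... | yes refl | no θa≢θc | _ =
    inj₁ (cong (θa ∷_) (sameBranch-meetingOtherBranch⇒≡ m a b c θa≢θc eb ec))
  ... | no θa≢θb | yes refl | _ =
    inj₂ (inj₁ (cong (θa ∷_) (sameBranch-meetingOtherBranch⇒≡ m a c b θa≢θb ec eb)))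
  ... | no θa≢θb | no _ | yes refl =
    inj₂ (inj₂ (cong (θb ∷_)
      (sameBranch-meetingOtherBranch⇒≡ m b c a (≢-sym θa≢θb) (trans (sym eb) ec) (sym eb))))
  ... | no θa≢θb | no θa≢θc | no θb≢θc =
    ⊥-elim (S-Glue.canon-noThreeCopies (m + k) θa≢θb θa≢θc θb≢θc eb ec)

module Forts (G : Graph) where
  open Graph G
  open PowerDomination G

  -- The constructive form of "no vertex outside F has exactly one neighbour in F".
  IsFort : (V → Set) → Set
  IsFort F = ∀ {v x} → F x → Adj v x →
    F v ⊎ ∃₂ λ b c → F b × F c × b ≢ c × Adj v b × Adj v c

  fort-unobserved : ∀ {F D} → IsFort F → (∀ {d x} → d ∈ D → InN d x → ¬ F x) →
    ∀ i {x} → F x → ¬ P i D x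
  fort-unobserved fort avoid zero    Fx (d , d∈D , dx) = avoid d∈D dx Fx
  fort-unobserved {F} {D} fort avoid (suc i) {x} Fx (v , Pv , forces , vx) = unforced vx
    where
    unobserved : ∀ {y} → F y → ¬ P i D y
    unobserved = fort-unobserved fort avoid i

    unforced : InN v x → ⊥
    unforced (inj₁ x≡v) = unobserved (subst F x≡v Fx) Pv
    unforced (inj₂ vx) with fort Fx vx
    ... | inj₁ Fv = unobserved Fv Pv
    ... | inj₂ (b , c , Fb , Fc , b≢c , vb , vc) =
      b≢c (forces b c (inj₂ vb) (unobserved Fb) (inj₂ vc) (unobserved Fc))

  powerDominating-meetsFort : ∀ {F D x} → IsPowerDominating D → IsFort F → F x →
    ¬ (∀ {d y} → d ∈ D → InN d y → ¬ F y)
  powerDominating-meetsFort {x = x} pd fort Fx avoid =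
    fort-unobserved fort avoid (proj₁ (pd x)) Fx (proj₂ (pd x))

Inner₁ : Vertex 1 → Set
Inner₁ u = ¬ IsOutmost (S 1) u

inner₀₁ inner₀₂ inner₁₂ : Vertex 1
inner₀₁ = (zero , suc zero) , tt
inner₀₂ = (zero , suc (suc zero)) , tt
inner₁₂ = (suc zero , suc (suc zero)) , tt

inner₀₁-inner : Inner₁ inner₀₁
inner₀₁-inner = from-no (outmost? (S 1) inner₀₁)

inner₀₂-inner : Inner₁ inner₀₂
inner₀₂-inner = from-no (outmost? (S 1) inner₀₂)

inner₁₂-inner : Inner₁ inner₁₂
inner₁₂-inner = from-no (outmost? (S 1) inner₁₂)

S₁-outmost-innerNeighbours : ∀ s → ∃₂ λ u w →
  Inner₁ u × Inner₁ w × u ≢ w × Adjacent 1 (outmost (S 1) s) u × Adjacent 1 (outmost (S 1) s) w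
S₁-outmost-innerNeighbours zero =
  inner₀₁ , inner₀₂ , inner₀₁-inner , inner₀₂-inner , (λ ()) ,
  (zero , zero , suc zero , (λ ()) , refl , refl) , (zero , zero , suc (suc zero) , (λ ()) , refl , refl)
S₁-outmost-innerNeighbours (suc zero) =
  inner₀₁ , inner₁₂ , inner₀₁-inner , inner₁₂-inner , (λ ()) ,
  (suc zero , suc zero , zero , (λ ()) , refl , refl) , (suc zero , suc zero , suc (suc zero) , (λ ()) , refl , refl)
S₁-outmost-innerNeighbours (suc (suc zero)) =
  inner₀₂ , inner₁₂ , inner₀₂-inner , inner₁₂-inner , (λ ()) ,
  (suc (suc zero) , suc (suc zero) , zero , (λ ()) , refl , refl) ,
  (suc (suc zero) , suc (suc zero) , suc zero , (λ ()) , refl , refl)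

S₁-vertices : List (Vertex 1)
S₁-vertices = outmost (S 1) zero ∷ outmost (S 1) (suc zero) ∷ outmost (S 1) (suc (suc zero))
            ∷ inner₀₁ ∷ inner₀₂ ∷ inner₁₂ ∷ []

S₁-vertices-complete : ∀ u → u ∈ S₁-vertices
S₁-vertices-complete ((zero , zero) , tt)                   = here refl
S₁-vertices-complete ((suc zero , suc zero) , tt)           = there (here refl)
S₁-vertices-complete ((suc (suc zero) , suc (suc zero)) , tt) = there (there (here refl))
S₁-vertices-complete ((zero , suc zero) , tt)               = there (there (there (here refl)))
S₁-vertices-complete ((zero , suc (suc zero)) , tt)         = there (there (there (there (here refl))))
S₁-vertices-complete ((suc zero , suc (suc zero)) , tt)     = there (there (there (there (there (here refl)))))
S₁-vertices-complete ((suc zero , zero) , ())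
S₁-vertices-complete ((suc (suc zero) , zero) , ())
S₁-vertices-complete ((suc (suc zero) , suc zero) , ())

∃-S₁? : {P : Vertex 1 → Set} → (∀ u → Dec (P u)) → Dec (∃ P)
∃-S₁? P? = map′ satisfied (λ (u , p) → lose (S₁-vertices-complete u) p) (any? P? S₁-vertices)

module CopiesOfS₁ (m : ℕ) where
  open Copies 1
  open PowerDomination (S (m + 1))
  open Forts (S (m + 1))

  Interior : Address m → Vertex (m + 1) → Set
  Interior a x = ∃ λ u → Inner₁ u × x ≡ embed m a u

  interior-isFort : ∀ a → IsFort (Interior a)
  interior-isFort a (u , u-inner , refl) adj with embed-neighbour m a u-inner adj
  ... | w , refl with outmost? (S 1) w
  ...   | no w-inner = inj₁ (w , w-inner , refl)
  ...   | yes (s , refl) with S₁-outmost-innerNeighbours s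
  ...     | i , j , i-inner , j-inner , i≢j , adj-i , adj-j =
    inj₂ (embed m a i , embed m a j , (i , i-inner , refl) , (j , j-inner , refl) ,
          i≢j ∘ embed-injective m a , embed-adjacent m a adj-i , embed-adjacent m a adj-j)

  powerDominating-meetsCopies : ∀ {D} → IsPowerDominating D → ∀ a → Any (InCopy m a) D
  powerDominating-meetsCopies {D} pd a
    with any? (λ d → ∃-S₁? (λ u → Graph._≟_ (S (m + 1)) d (embed m a u))) D
  ... | yes met = met
  ... | no missed =
    ⊥-elim (powerDominating-meetsFort pd (interior-isFort a) (inner₀₁ , inner₀₁-inner , refl) avoid)
    where
    avoid : ∀ {d y} → d ∈ D → InN d y → ¬ Interior a y
    avoid d∈D (inj₁ refl) (u , _ , refl) = missed (lose d∈D (u , refl))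
    avoid d∈D (inj₂ adj) (u , u-inner , refl) = missed (lose d∈D (embed-neighbour m a u-inner adj))

AtMostTwoToOne : ∀ {n l} → (Fin n → Fin l) → Set
AtMostTwoToOne f = ∀ i j k → f i ≡ f j → f i ≡ f k → i ≡ j ⊎ i ≡ k ⊎ j ≡ k

-- Tagging each point with whether an earlier point has the same image makes
-- an at most two-to-one map injective.
atMostTwoToOne⇒≤ : ∀ {n l} (f : Fin n → Fin l) → AtMostTwoToOne f → n ≤ 2 * l
atMostTwoToOne⇒≤ {n} {l} f two =
  subst (n ≤_) (*-comm l 2) (Fin.injective⇒≤ {f = tagged} (λ {i} {j} → tagged-injective i j))
  where
  Repeated : Fin n → Set
  Repeated i = ∃ λ j → j <ᶠ i × f j ≡ f i

  repeated? : ∀ i → Dec (Repeated i)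
  repeated? i = Fin.any? (λ j → (j Fin.<? i) ×-dec (f j Fin.≟ f i))

  tag : ∀ {A : Set} → Dec A → Fin 2
  tag (yes _) = suc zero
  tag (no _)  = zero

  tagged : Fin n → Fin (l * 2)
  tagged i = combine (f i) (tag (repeated? i))

  sameTag-impossible : ∀ {i j} → i <ᶠ j → f i ≡ f j →
    (ri : Dec (Repeated i)) (rj : Dec (Repeated j)) → tag ri ≡ tag rj → ⊥
  sameTag-impossible {i} {j} i<j fi≡fj (yes (h , h<i , fh≡fi)) _ _
    with two h i j fh≡fi (trans fh≡fi fi≡fj)
  ... | inj₁ h≡i        = Fin.<⇒≢ h<i h≡i
  ... | inj₂ (inj₁ h≡j) = Fin.<⇒≢ (Fin.<-trans h<i i<j) h≡j
  ... | inj₂ (inj₂ i≡j) = Fin.<⇒≢ i<j i≡j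
  sameTag-impossible _ _ (no _) (yes _) ()
  sameTag-impossible {i} i<j fi≡fj (no _) (no not-rj) _ = not-rj (i , i<j , fi≡fj)

  tagged-injective : ∀ i j → tagged i ≡ tagged j → i ≡ j
  tagged-injective i j e with Fin.combine-injective (f i) _ (f j) _ e | Fin.<-cmp i j
  ... | _ | tri≈ _ i≡j _ = i≡j
  ... | fi≡fj , same | tri< i<j _ _ = ⊥-elim (sameTag-impossible i<j fi≡fj _ _ same)
  ... | fi≡fj , same | tri> _ _ j<i = ⊥-elim (sameTag-impossible j<i (sym fi≡fj) _ _ (sym same))

toAddress : ∀ m → Fin (3 ^ m) → Vec (Fin 3) m
toAddress zero    _ = []
toAddress (suc m) i = proj₁ (remQuot {3} (3 ^ m) i) ∷ toAddress m (proj₂ (remQuot {3} (3 ^ m) i))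

toAddress-injective : ∀ m {i j} → toAddress m i ≡ toAddress m j → i ≡ j
toAddress-injective zero    {zero} {zero} _ = refl
toAddress-injective (suc m) {i} {j} e = begin
  i                                   ≡⟨ Fin.combine-remQuot {3} (3 ^ m) i ⟨
  uncurry combine (remQuot {3} (3 ^ m) i) ≡⟨ cong (uncurry combine) same-remQuot ⟩
  uncurry combine (remQuot {3} (3 ^ m) j) ≡⟨ Fin.combine-remQuot {3} (3 ^ m) j ⟩
  j                                   ∎
  where
  open ≡-Reasoning
  same-remQuot : remQuot {3} (3 ^ m) i ≡ remQuot {3} (3 ^ m) j
  same-remQuot = cong₂ _,_ (∷-injectiveˡ e) (toAddress-injective m (∷-injectiveʳ e))

3^m%2≡1 : ∀ m → 3 ^ m % 2 ≡ 1
3^m%2≡1 zero    = refl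
3^m%2≡1 (suc m) = begin
  (3 ^ m + 2 * 3 ^ m) % 2 ≡⟨ cong (λ n → (3 ^ m + n) % 2) (*-comm 2 (3 ^ m)) ⟩
  (3 ^ m + 3 ^ m * 2) % 2 ≡⟨ [m+kn]%n≡m%n (3 ^ m) (3 ^ m) 2 ⟩
  3 ^ m % 2               ≡⟨ 3^m%2≡1 m ⟩
  1                       ∎
  where open ≡-Reasoning

3^m≢2*n : ∀ m n → 3 ^ m ≢ 2 * n
3^m≢2*n m n e with trans (sym (3^m%2≡1 m)) (trans (cong (_% 2) (trans e (*-comm 2 n))) (m*n%n≡0 n 2))
... | ()

3^m≤2*n⇒3^m+1≤2*n : ∀ m n → 3 ^ m ≤ 2 * n → 3 ^ m + 1 ≤ 2 * n
3^m≤2*n⇒3^m+1≤2*n m n le = subst (_≤ 2 * n) (+-comm 1 (3 ^ m)) (≤∧≢⇒< le (3^m≢2*n m n))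

module CopyCounting (k : ℕ) where
  open Copies k

  meetsAllCopies⇒bound : ∀ m (D : List (Vertex (m + k))) → (∀ a → Any (InCopy m a) D) →
    3 ^ m + 1 ≤ 2 * length D
  meetsAllCopies⇒bound m D meets =
    3^m≤2*n⇒3^m+1≤2*n m (length D) (atMostTwoToOne⇒≤ dominatorOf twoToOne)
    where
    dominatorOf : Fin (3 ^ m) → Fin (length D)
    dominatorOf i = index (meets (toAddress m i))

    inCopy : ∀ i j → dominatorOf i ≡ dominatorOf j →
      InCopy m (toAddress m j) (lookup D (dominatorOf i))
    inCopy i j e =
      subst (InCopy m (toAddress m j) ∘ lookup D) (sym e) (lookup-index (meets (toAddress m j)))

    twoToOne : AtMostTwoToOne dominatorOf
    twoToOne i j l eij eil =
      Sum.map (toAddress-injective m) (Sum.map (toAddress-injective m) (toAddress-injective m))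
        (atMostTwoCopies m (toAddress m i) (toAddress m j) (toAddress m l)
          (lookup-index (meets (toAddress m i))) (inCopy i j eij) (inCopy i l eil))

S-lowerBound : ∀ m (D : List (Vertex (m + 1))) →
  PowerDomination.IsPowerDominating (S (m + 1)) D → 3 ^ m + 1 ≤ 2 * length D
S-lowerBound m D pd =
  CopyCounting.meetsAllCopies⇒bound 1 m D (CopiesOfS₁.powerDominating-meetsCopies m pd)

lemma6 : (g : ℕ) → 2 ≤ g → (D : List (Graph.V (S (g ∸ 1)))) → Unique D
    → PowerDomination.IsPowerDominating (S (g ∸ 1)) D
    → 3 ^ (g ∸ 2) + 1 ≤ 2 * length D
lemma6 (suc (suc m)) _ D _ =
  subst (λ n → (D : List (Vertex n)) →
                PowerDomination.IsPowerDominating (S n) D → 3 ^ m + 1 ≤ 2 * length D)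
        (+-comm m 1) (S-lowerBound m) D
lemma6 (suc zero) (s≤s ())
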